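{- For every integer $n\ge 2$, \[ \gamma_{2t}(K_n\Box K_n)=\begin{cases}3n/2, & n\equiv 0 \pmod 4,\\ (3n+1)/2, & n\equiv 1 \pmod 2,\\ (3n+2)/2, & n\equiv 2\pmod 4.\end{cases} \]
   Context: $K_n$ denotes the complete graph on $n$ vertices. The Cartesian product $G\Box H$ has vertex set $V(G)\times V(H)$, with $(u_1,v_1)\sim(u_2,v_2)$ iff either $u_1=u_2$ and $v_1\sim v_2$, or $v_1=v_2$ and $u_1\sim u_2$. A set $S$ of vertices of a graph $G$ is total $2$-dominating if every vertex of $G$ is adjacent to at least two vertices of $S$; $\gamma_{2t}(G)$ is the minimum cardinality of such a set. -}

module Defs where


open import Data.Nat using (ℕ; _+_; _*_; _≤_; _/_; _%_)
open import Data.Fin using (Fin)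
open import Data.Bool using (Bool; true; false; if_then_else_)
open import Data.List using (List; map; allFin)
open import Data.Nat.ListAction using (sum)
open import Data.Product using (_×_; _,_; ∃; ∃-syntax; proj₁; proj₂)
open import Data.Sum using (_⊎_)
open import Relation.Binary.PropositionalEquality using (_≡_; _≢_)

record Graph : Set₁ where
  field
    V   : Set
    Adj : V → V → Set
open Graph public

K : ℕ → Graph
K n = record { V = Fin n ; Adj = λ a b → a ≢ b }

_□_ : Graph → Graph → Graph
G □ H = record
  { V   = V G × V H
  ; Adj = λ x y → (proj₁ x ≡ proj₁ y × Adj H (proj₂ x) (proj₂ y))
                ⊎ (proj₂ x ≡ proj₂ y × Adj G (proj₁ x) (proj₁ y))
  }

IsTotal2Dominating : (G : Graph) → (V G → Bool) → Set
IsTotal2Dominating G S =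
  ∀ v → ∃[ a ] ∃[ b ] (a ≢ b × S a ≡ true × S b ≡ true × Adj G v a × Adj G v b)

card : (n : ℕ) → (Fin n × Fin n → Bool) → ℕ
card n S = sum (map (λ i → sum (map (λ j → if S (i , j) then 1 else 0) (allFin n))) (allFin n))

γ2t-KnKn≡ : ℕ → ℕ → Set
γ2t-KnKn≡ n k =
  (∃[ S ] (IsTotal2Dominating (K n □ K n) S × card n S ≡ k))
  × (∀ S → IsTotal2Dominating (K n □ K n) S → k ≤ card n S)

formula : ℕ → ℕ
formula n with n % 4
... | 0 = (3 * n) / 2
... | 2 = (3 * n + 2) / 2
... | _ = (3 * n + 1) / 2

-- Let r i and c j be the numbers of members of S in row i and column j. A vertex (i , j) sees
-- its two neighbours in S inside row i and column j, so r i + c j ≥ 2, and r i + c j ≥ 4 when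
-- (i , j) ∈ S. If some line is empty, every line crossing it holds two members and |S| ≥ 2n.
-- Otherwise let every line of size r hand share r to each of its members: a member receives at
-- most 16, while a line hands out at least 12, strictly more unless r ∈ {1, 3}. Hence
-- 24n ≤ 16|S|, and in case of equality every row has 1 or 3 members, so |S| = n + 2Q and
-- 2|S| = 3n forces n = 4Q. Conversely, sets of the claimed size are checked by evaluation for
-- n = 2, …, 5, and S₄ and a set for n placed as diagonal blocks give one for n + 4: since every
-- line of both blocks is occupied, a vertex off the blocks sees a member in its row and one in
-- its column.

module Submission where

open import Defs
open import Data.Bool using (Bool; true; false; if_then_else_; _∧_)
  renaming (_≟_ to _≟ᵇ_)
open import Data.Fin using (Fin; zero; suc; toℕ; _↑ˡ_; _↑ʳ_; splitAt)
open import Data.Fin.Properties using (all?; any?; ↑ˡ-injective; ↑ʳ-injective; splitAt-↑ˡ; splitAt-↑ʳ)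
  renaming (_≟_ to _≟ᶠ_)
open import Data.List using (List; []; _∷_; length; map; tabulate; allFin)
open import Data.Bool.ListAction using (any)
open import Data.List.Properties using (map-tabulate)
open import Data.List.Relation.Unary.All as All using (All; []; _∷_)
open import Data.List.Relation.Unary.Unique.Propositional using (Unique; []; _∷_)
open import Data.Nat.ListAction using () renaming (sum to listSum)
open import Data.Nat using (ℕ; zero; suc; _+_; _*_; _/_; _%_; _≤_; _<_; _≡ᵇ_; z≤n; s≤s)
open import Data.Nat.Properties
open import Data.Nat.DivMod using (+-distrib-/-∣ˡ; m<n*o⇒m/o<n)
open import Data.Nat.Divisibility using (_∣_; divides; divides-refl; _∣0; n∣m⇒m%n≡0)
open import Data.Nat.Solver using (module +-*-Solver)
open import Data.Product using (_×_; _,_; proj₁; proj₂; ∃; ∃-syntax)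
open import Data.Product.Properties using (≡-dec)
open import Data.Sum using (_⊎_; inj₁; inj₂)
open import Data.Unit using (tt)
open import Function using (_∘_; case_of_)
open import Relation.Nullary using (¬_; Dec; does; yes; no)
open import Relation.Nullary.Decidable using (True; toWitness; _×-dec_; _⊎-dec_; ¬?; map′; dec-false)
open import Relation.Binary.PropositionalEquality
open import Algebra.Properties.CommutativeMonoid.Sum +-0-commutativeMonoid
  using (sum; sum-cong-≗; ∑-distrib-+; ∑-comm)
open import Algebra.Properties.Semiring.Sum +-*-semiring using (*-distribˡ-sum; *-distribʳ-sum)
open import Algebra.Properties.CommutativeSemigroup +-commutativeSemigroup using (x∙yz≈y∙xz)

open +-*-Solver

listSum-tabulate : ∀ {n} (f : Fin n → ℕ) → listSum (tabulate f) ≡ sum f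
listSum-tabulate {zero}  f = refl
listSum-tabulate {suc n} f = cong (f zero +_) (listSum-tabulate (f ∘ suc))

listSum-allFin : ∀ {n} (f : Fin n → ℕ) → listSum (map f (allFin n)) ≡ sum f
listSum-allFin {n} f = trans (cong listSum (map-tabulate {n = n} (λ i → i) f)) (listSum-tabulate f)

sum-mono-≤ : ∀ {n} {f g : Fin n → ℕ} → (∀ i → f i ≤ g i) → sum f ≤ sum g
sum-mono-≤ {zero}  f≤g = z≤n
sum-mono-≤ {suc n} f≤g = +-mono-≤ (f≤g zero) (sum-mono-≤ (f≤g ∘ suc))

sum-const : ∀ n c → sum {n} (λ _ → c) ≡ n * c
sum-const zero    c = refl
sum-const (suc n) c = cong (c +_) (sum-const n c)

sum≡0⇒≡0 : ∀ {n} (f : Fin n → ℕ) → sum f ≡ 0 → ∀ i → f i ≡ 0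
sum≡0⇒≡0 f sum≡0 zero    = m+n≡0⇒m≡0 (f zero) sum≡0
sum≡0⇒≡0 f sum≡0 (suc i) = sum≡0⇒≡0 (f ∘ suc) (m+n≡0⇒n≡0 (f zero) sum≡0) i

sum-↑ : ∀ a {b} (f : Fin (a + b) → ℕ) → sum f ≡ sum (λ i → f (i ↑ˡ b)) + sum (λ j → f (a ↑ʳ j))
sum-↑ zero    f = refl
sum-↑ (suc a) f = trans (cong (f zero +_) (sum-↑ a (f ∘ suc))) (sym (+-assoc (f zero) _ _))

𝟙 : Bool → ℕ
𝟙 b = if b then 1 else 0

count : ∀ {n} → (Fin n → Bool) → ℕ
count b = sum (𝟙 ∘ b)

count-false : ∀ {n} (b : Fin n → Bool) → (∀ j → b j ≡ false) → count b ≡ 0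
count-false {n} b b≡false = trans (sum-cong-≗ (cong 𝟙 ∘ b≡false)) (trans (sum-const n 0) (*-zeroʳ n))

erase : ∀ {n} → (Fin n → Bool) → Fin n → Fin n → Bool
erase b x y = if does (y ≟ᶠ x) then false else b y

count-erase : ∀ {n} (b : Fin n → Bool) x → count b ≡ 𝟙 (b x) + count (erase b x)
count-erase b zero    = refl
count-erase b (suc x) = trans (cong (𝟙 (b zero) +_) (count-erase (b ∘ suc) x))
                              (x∙yz≈y∙xz (𝟙 (b zero)) (𝟙 (b (suc x))) _)

erase-true : ∀ {n} {b : Fin n → Bool} {x y} → x ≢ y → b y ≡ true → erase b x y ≡ true
erase-true {x = x} {y} x≢y by rewrite dec-false (y ≟ᶠ x) (x≢y ∘ sym) = by

length≤count : ∀ {n} {b : Fin n → Bool} {xs} → Unique xs → All (λ x → b x ≡ true) xs → length xs ≤ count b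
length≤count []                  []         = z≤n
length≤count {b = b} {x ∷ _} (x∉xs ∷ xs!) (bx ∷ bxs) rewrite count-erase b x | bx =
  s≤s (length≤count {b = erase b x} xs! (All.zipWith (λ (x≢y , by) → erase-true {b = b} x≢y by) (x∉xs , bxs)))

module _ {n} {b : Fin n → Bool} where

  1≤count : ∀ {x} → b x ≡ true → 1 ≤ count b
  1≤count {x} bx = length≤count {xs = x ∷ []} ([] ∷ []) (bx ∷ [])

  2≤count : ∀ {x y} → x ≢ y → b x ≡ true → b y ≡ true → 2 ≤ count b
  2≤count {x} {y} x≢y bx by = length≤count {xs = x ∷ y ∷ []} ((x≢y ∷ []) ∷ [] ∷ []) (bx ∷ by ∷ [])

  3≤count : ∀ {x y z} → x ≢ y → x ≢ z → y ≢ z → b x ≡ true → b y ≡ true → b z ≡ true → 3 ≤ count b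
  3≤count {x} {y} {z} x≢y x≢z y≢z bx by bz =
    length≤count {xs = x ∷ y ∷ z ∷ []} ((x≢y ∷ x≢z ∷ []) ∷ (y≢z ∷ []) ∷ [] ∷ []) (bx ∷ by ∷ bz ∷ [])

share : ℕ → ℕ
share 1 = 12
share 2 = 7
share _ = 4

excess : ℕ → ℕ
excess 1 = 0
excess 3 = 0
excess _ = 1

share≤12 : ∀ r → share r ≤ 12
share≤12 0                   = ≤ᵇ⇒≤ 4 12 tt
share≤12 1                   = ≤-refl
share≤12 2                   = ≤ᵇ⇒≤ 7 12 tt
share≤12 (suc (suc (suc r))) = ≤ᵇ⇒≤ 4 12 tt

share+share≤16 : ∀ r c → 4 ≤ r + c → share r + share c ≤ 16
share+share≤16 0                   c                   _ = +-monoʳ-≤ 4 (share≤12 c)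
share+share≤16 (suc (suc (suc r))) c                   _ = +-monoʳ-≤ 4 (share≤12 c)
share+share≤16 1                   0                   _ = ≤-refl
share+share≤16 1                   (suc (suc (suc c))) _ = ≤-refl
share+share≤16 2                   0                   _ = ≤ᵇ⇒≤ 11 16 tt
share+share≤16 2                   2                   _ = ≤ᵇ⇒≤ 14 16 tt
share+share≤16 2                   (suc (suc (suc c))) _ = ≤ᵇ⇒≤ 11 16 tt
share+share≤16 1                   1                   (s≤s (s≤s ()))
share+share≤16 1                   2                   (s≤s (s≤s (s≤s ())))
share+share≤16 2                   1                   (s≤s (s≤s (s≤s ())))

12+excess≤*share : ∀ r → 1 ≤ r → 12 + excess r ≤ r * share r
12+excess≤*share 1                         _ = ≤-refl
12+excess≤*share 2                         _ = ≤ᵇ⇒≤ 13 14 tt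
12+excess≤*share 3                         _ = ≤-refl
12+excess≤*share (suc (suc (suc (suc r)))) _ = ≤-trans (≤ᵇ⇒≤ 13 16 tt) (*-monoˡ-≤ 4 (m≤m+n 4 r))

excess≡0⇒odd : ∀ r → excess r ≡ 0 → r ≡ 1 + 2 * (r / 2)
excess≡0⇒odd 1 _ = refl
excess≡0⇒odd 3 _ = refl
excess≡0⇒odd 0                         ()
excess≡0⇒odd 2                         ()
excess≡0⇒odd (suc (suc (suc (suc r)))) ()

ThreeHalvesBound : ℕ → ℕ → Set
ThreeHalvesBound n k = 3 * n ≤ 2 * k × (2 * k ≡ 3 * n → 4 ∣ n)

2n≤k⇒threeHalvesBound : ∀ {n k} → 2 * n ≤ k → ThreeHalvesBound n k
2n≤k⇒threeHalvesBound {n} {k} 2n≤k = ≤-trans (*-monoˡ-≤ n (≤ᵇ⇒≤ 3 4 tt)) 4n≤2k , λ 2k≡3n →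
  subst (4 ∣_) (sym (n≤0⇒n≡0 (+-cancelʳ-≤ (3 * n) n 0 (≤-trans 4n≤2k (≤-reflexive 2k≡3n))))) (4 ∣0)
  where
  4n≤2k : 4 * n ≤ 2 * k
  4n≤2k = ≤-trans (≤-reflexive (solve 1 (λ n → con 4 :* n := con 2 :* (con 2 :* n)) refl n)) (*-monoʳ-≤ 2 2n≤k)


module _ {n} (S : Fin n × Fin n → Bool) where

  row : Fin n → Fin n → Bool
  row i j = S (i , j)

  col : Fin n → Fin n → Bool
  col j i = S (i , j)

  rowCount : Fin n → ℕ
  rowCount = count ∘ row

  colCount : Fin n → ℕ
  colCount = count ∘ col

  card≡∑rowCount : card n S ≡ sum rowCount
  card≡∑rowCount =
    trans (listSum-allFin (λ i → listSum (map (𝟙 ∘ row i) (allFin n))))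
          (sum-cong-≗ (λ i → listSum-allFin (𝟙 ∘ row i)))

  card≡∑colCount : card n S ≡ sum colCount
  card≡∑colCount = trans card≡∑rowCount (∑-comm (λ i j → 𝟙 (S (i , j))))

  ∑-scaled-entries : ∀ c → sum (λ i → sum (λ j → c * 𝟙 (S (i , j)))) ≡ c * card n S
  ∑-scaled-entries c = sym (begin
    c * card n S                               ≡⟨ cong (c *_) card≡∑rowCount ⟩
    c * sum rowCount                           ≡⟨ *-distribˡ-sum c rowCount ⟩
    sum (λ i → c * rowCount i)                 ≡⟨ sum-cong-≗ (λ i → *-distribˡ-sum c (𝟙 ∘ row i)) ⟩
    sum (λ i → sum (λ j → c * 𝟙 (S (i , j)))) ∎)
    where open ≡-Reasoning

  ∑-line-weights : (w : ℕ → ℕ) →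
    sum (λ i → rowCount i * w (rowCount i)) + sum (λ j → colCount j * w (colCount j))
    ≡ sum (λ i → sum (λ j → 𝟙 (S (i , j)) * (w (rowCount i) + w (colCount j))))
  ∑-line-weights w = begin
    sum (λ i → rowCount i * wr i) + sum (λ j → colCount j * wc j)
      ≡⟨ cong₂ _+_ (sum-cong-≗ (λ i → *-distribʳ-sum (wr i) (𝟙 ∘ row i)))
                   (sum-cong-≗ (λ j → *-distribʳ-sum (wc j) (𝟙 ∘ col j))) ⟩
    sum (λ i → sum (λ j → e i j * wr i)) + sum (λ j → sum (λ i → e i j * wc j))
      ≡⟨ cong (sum (λ i → sum (λ j → e i j * wr i)) +_) (∑-comm (λ j i → e i j * wc j)) ⟩
    sum (λ i → sum (λ j → e i j * wr i)) + sum (λ i → sum (λ j → e i j * wc j))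
      ≡⟨ ∑-distrib-+ (λ i → sum (λ j → e i j * wr i)) _ ⟨
    sum (λ i → sum (λ j → e i j * wr i) + sum (λ j → e i j * wc j))
      ≡⟨ sum-cong-≗ (λ i → ∑-distrib-+ (λ j → e i j * wr i) _) ⟨
    sum (λ i → sum (λ j → e i j * wr i + e i j * wc j))
      ≡⟨ sum-cong-≗ (λ i → sum-cong-≗ (λ j → *-distribˡ-+ (e i j) (wr i) (wc j))) ⟨
    sum (λ i → sum (λ j → e i j * (wr i + wc j))) ∎
    where
    open ≡-Reasoning
    e : Fin n → Fin n → ℕ
    e i j = 𝟙 (S (i , j))
    wr wc : Fin n → ℕ
    wr = w ∘ rowCount
    wc = w ∘ colCount

  module _ (dom : IsTotal2Dominating (K n □ K n) S) where

    2≤rowCount+colCount : ∀ i j → 2 ≤ rowCount i + colCount j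
    2≤rowCount+colCount i j with dom (i , j)
    ... | (_ , p) , (_ , q) , p≢q , Sp , Sq , inj₁ (refl , _) , inj₁ (refl , _) =
      ≤-trans (2≤count {b = row i} (p≢q ∘ cong (i ,_)) Sp Sq) (m≤m+n _ _)
    ... | (_ , p) , (q , _) , _ , Sp , Sq , inj₁ (refl , _) , inj₂ (refl , _) =
      +-mono-≤ (1≤count {b = row i} Sp) (1≤count {b = col j} Sq)
    ... | (p , _) , (_ , q) , _ , Sp , Sq , inj₂ (refl , _) , inj₁ (refl , _) =
      +-mono-≤ (1≤count {b = row i} Sq) (1≤count {b = col j} Sp)
    ... | (p , _) , (q , _) , p≢q , Sp , Sq , inj₂ (refl , _) , inj₂ (refl , _) =
      ≤-trans (2≤count {b = col j} (p≢q ∘ cong (_, j)) Sp Sq) (m≤n+m _ _)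

    4≤rowCount+colCount : ∀ i j → S (i , j) ≡ true → 4 ≤ rowCount i + colCount j
    4≤rowCount+colCount i j Sij with dom (i , j)
    ... | (_ , p) , (_ , q) , p≢q , Sp , Sq , inj₁ (refl , j≢p) , inj₁ (refl , j≢q) =
      +-mono-≤ (3≤count {b = row i} j≢p j≢q (p≢q ∘ cong (i ,_)) Sij Sp Sq) (1≤count {b = col j} Sij)
    ... | (_ , p) , (q , _) , _ , Sp , Sq , inj₁ (refl , j≢p) , inj₂ (refl , i≢q) =
      +-mono-≤ (2≤count {b = row i} j≢p Sij Sp) (2≤count {b = col j} i≢q Sij Sq)
    ... | (p , _) , (_ , q) , _ , Sp , Sq , inj₂ (refl , i≢p) , inj₁ (refl , j≢q) =
      +-mono-≤ (2≤count {b = row i} j≢q Sij Sq) (2≤count {b = col j} i≢p Sij Sp)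
    ... | (p , _) , (q , _) , p≢q , Sp , Sq , inj₂ (refl , i≢p) , inj₂ (refl , i≢q) =
      +-mono-≤ (1≤count {b = row i} Sij) (3≤count {b = col j} i≢p i≢q (p≢q ∘ cong (_, j)) Sij Sp Sq)

    emptyRow⇒2n≤card : ∀ i → rowCount i ≡ 0 → 2 * n ≤ card n S
    emptyRow⇒2n≤card i row≡0 = begin
      2 * n             ≡⟨ *-comm 2 n ⟩
      n * 2             ≡⟨ sum-const n 2 ⟨
      sum {n} (λ _ → 2) ≤⟨ sum-mono-≤ (λ j → subst (λ r → 2 ≤ r + colCount j) row≡0 (2≤rowCount+colCount i j)) ⟩
      sum colCount      ≡⟨ card≡∑colCount ⟨
      card n S          ∎
      where open ≤-Reasoning

    emptyCol⇒2n≤card : ∀ j → colCount j ≡ 0 → 2 * n ≤ card n S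
    emptyCol⇒2n≤card j col≡0 = begin
      2 * n                      ≡⟨ *-comm 2 n ⟩
      n * 2                      ≡⟨ sum-const n 2 ⟨
      sum {n} (λ _ → 2)          ≤⟨ sum-mono-≤ (λ i → subst (λ c → 2 ≤ rowCount i + c) col≡0 (2≤rowCount+colCount i j)) ⟩
      sum (λ i → rowCount i + 0) ≡⟨ sum-cong-≗ (λ i → +-identityʳ (rowCount i)) ⟩
      sum rowCount               ≡⟨ card≡∑rowCount ⟨
      card n S                   ∎
      where open ≤-Reasoning

    member-charge : ∀ i j → 𝟙 (S (i , j)) * (share (rowCount i) + share (colCount j)) ≤ 16 * 𝟙 (S (i , j))
    member-charge i j with S (i , j) in Sij
    ... | true  = ≤-trans (≤-reflexive (+-identityʳ _))
                          (share+share≤16 (rowCount i) (colCount j) (4≤rowCount+colCount i j Sij))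
    ... | false = z≤n

    module _ (rowsOccupied : ∀ i → 1 ≤ rowCount i) (colsOccupied : ∀ j → 1 ≤ colCount j) where

      discharging : 8 * (3 * n) + sum (excess ∘ rowCount) ≤ 8 * (2 * card n S)
      discharging = begin
        8 * (3 * n) + sum (excess ∘ rowCount)
          ≡⟨ solve 2 (λ n x → con 8 :* (con 3 :* n) :+ x := (n :* con 12 :+ x) :+ n :* con 12) refl n _ ⟩
        (n * 12 + sum (excess ∘ rowCount)) + n * 12
          ≡⟨ cong₂ _+_ (trans (cong (_+ sum (excess ∘ rowCount)) (sym (sum-const n 12)))
                              (sym (∑-distrib-+ (λ _ → 12) (excess ∘ rowCount))))
                       (sym (sum-const n 12)) ⟩
        sum (λ i → 12 + excess (rowCount i)) + sum {n} (λ _ → 12)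
          ≤⟨ +-mono-≤ (sum-mono-≤ (λ i → 12+excess≤*share _ (rowsOccupied i)))
                      (sum-mono-≤ (λ j → ≤-trans (m≤m+n 12 _) (12+excess≤*share _ (colsOccupied j)))) ⟩
        sum (λ i → rowCount i * share (rowCount i)) + sum (λ j → colCount j * share (colCount j))
          ≡⟨ ∑-line-weights share ⟩
        sum (λ i → sum (λ j → 𝟙 (S (i , j)) * (share (rowCount i) + share (colCount j))))
          ≤⟨ sum-mono-≤ (λ i → sum-mono-≤ (member-charge i)) ⟩
        sum (λ i → sum (λ j → 16 * 𝟙 (S (i , j))))
          ≡⟨ ∑-scaled-entries 16 ⟩
        16 * card n S
          ≡⟨ *-assoc 8 2 (card n S) ⟩
        8 * (2 * card n S) ∎
        where open ≤-Reasoning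

      3n≤2card : 3 * n ≤ 2 * card n S
      3n≤2card = *-cancelˡ-≤ 8 (≤-trans (m≤m+n _ _) discharging)

      2card≡3n⇒4∣n : 2 * card n S ≡ 3 * n → 4 ∣ n
      2card≡3n⇒4∣n 2k≡3n = divides Q (sym Q*4≡n)
        where
        open ≡-Reasoning
        noExcess : sum (excess ∘ rowCount) ≡ 0
        noExcess = n≤0⇒n≡0 (+-cancelˡ-≤ (8 * (3 * n)) _ 0 (≤-trans discharging (≤-reflexive (begin
          8 * (2 * card n S) ≡⟨ cong (8 *_) 2k≡3n ⟩
          8 * (3 * n)        ≡⟨ +-identityʳ _ ⟨
          8 * (3 * n) + 0    ∎))))
        Q : ℕ
        Q = sum (λ i → rowCount i / 2)
        card≡n+2Q : card n S ≡ n + 2 * Q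
        card≡n+2Q = begin
          card n S
            ≡⟨ card≡∑rowCount ⟩
          sum rowCount
            ≡⟨ sum-cong-≗ (λ i → excess≡0⇒odd (rowCount i) (sum≡0⇒≡0 _ noExcess i)) ⟩
          sum (λ i → 1 + 2 * (rowCount i / 2))
            ≡⟨ ∑-distrib-+ (λ _ → 1) (λ i → 2 * (rowCount i / 2)) ⟩
          sum {n} (λ _ → 1) + sum (λ i → 2 * (rowCount i / 2))
            ≡⟨ cong₂ _+_ (trans (sum-const n 1) (*-identityʳ n)) (sym (*-distribˡ-sum 2 (λ i → rowCount i / 2))) ⟩
          n + 2 * Q ∎
        Q*4≡n : Q * 4 ≡ n
        Q*4≡n = +-cancelˡ-≡ (n + n) _ _ (begin
          (n + n) + Q * 4     ≡⟨ solve 2 (λ n q → (n :+ n) :+ q :* con 4 := con 2 :* (n :+ con 2 :* q)) refl n Q ⟩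
          2 * (n + 2 * Q)     ≡⟨ cong (2 *_) card≡n+2Q ⟨
          2 * card n S        ≡⟨ 2k≡3n ⟩
          3 * n               ≡⟨ solve 1 (λ n → con 3 :* n := (n :+ n) :+ n) refl n ⟩
          (n + n) + n         ∎)

    lowerBound : ThreeHalvesBound n (card n S)
    lowerBound with any? (λ i → rowCount i ≟ 0) | any? (λ j → colCount j ≟ 0)
    ... | yes (i , empty) | _               = 2n≤k⇒threeHalvesBound (emptyRow⇒2n≤card i empty)
    ... | no _            | yes (j , empty) = 2n≤k⇒threeHalvesBound (emptyCol⇒2n≤card j empty)
    ... | no noEmptyRow   | no noEmptyCol   = 3n≤2card occupiedRows occupiedCols , 2card≡3n⇒4∣n occupiedRows occupiedCols
      where
      occupiedRows : ∀ i → 1 ≤ rowCount i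
      occupiedRows i = n≢0⇒n>0 (noEmptyRow ∘ (i ,_))
      occupiedCols : ∀ j → 1 ≤ colCount j
      occupiedCols j = n≢0⇒n>0 (noEmptyCol ∘ (j ,_))

m≤1+2k⇒m/2≤k : ∀ m k → m ≤ 1 + 2 * k → m / 2 ≤ k
m≤1+2k⇒m/2≤k m k m≤1+2k = ≤-pred (m<n*o⇒m/o<n (s≤s (≤-trans m≤1+2k (≤-reflexive (cong suc (*-comm 2 k))))))

threeHalvesBound⇒< : ∀ {n k} → ThreeHalvesBound n k → ¬ 4 ∣ n → 3 * n < 2 * k
threeHalvesBound⇒< (3n≤2k , tight⇒4∣n) ∤n = ≤∧≢⇒< 3n≤2k (∤n ∘ tight⇒4∣n ∘ sym)

formula≤ : ∀ n k → ThreeHalvesBound n k → formula n ≤ k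
formula≤ n k bound@(3n≤2k , _) with n % 4 in n%4
... | 0                 = m≤1+2k⇒m/2≤k (3 * n) k (≤-trans 3n≤2k (n≤1+n _))
... | 1                 = m≤1+2k⇒m/2≤k (3 * n + 1) k (≤-trans (≤-reflexive (+-comm (3 * n) 1)) (s≤s 3n≤2k))
... | 2                 = m≤1+2k⇒m/2≤k (3 * n + 2) k (≤-trans (≤-reflexive (+-comm (3 * n) 2)) (s≤s 3n<2k))
  where
  3n<2k : 3 * n < 2 * k
  3n<2k = threeHalvesBound⇒< {n} {k} bound λ 4∣n → case trans (sym n%4) (n∣m⇒m%n≡0 n 4 4∣n) of λ ()
... | suc (suc (suc _)) = m≤1+2k⇒m/2≤k (3 * n + 1) k (≤-trans (≤-reflexive (+-comm (3 * n) 1)) (s≤s 3n≤2k))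

[12+m]/2≡6+m/2 : ∀ m → (12 + m) / 2 ≡ 6 + m / 2
[12+m]/2≡6+m/2 m = +-distrib-/-∣ˡ m {2} (divides-refl 6)

[3[4+n]+c]/2≡6+[3n+c]/2 : ∀ n c → (3 * (4 + n) + c) / 2 ≡ 6 + (3 * n + c) / 2
[3[4+n]+c]/2≡6+[3n+c]/2 n c =
  trans (cong (λ m → (m + c) / 2) (*-distribˡ-+ 3 4 n))
        (trans (cong (_/ 2) (+-assoc 12 (3 * n) c)) ([12+m]/2≡6+m/2 (3 * n + c)))

formula-step : ∀ n → formula (4 + n) ≡ 6 + formula n
formula-step n with n % 4
... | 0                 = trans (cong (_/ 2) (*-distribˡ-+ 3 4 n)) ([12+m]/2≡6+m/2 (3 * n))
... | 1                 = [3[4+n]+c]/2≡6+[3n+c]/2 n 1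
... | 2                 = [3[4+n]+c]/2≡6+[3n+c]/2 n 2
... | suc (suc (suc _)) = [3[4+n]+c]/2≡6+[3n+c]/2 n 1

LinesOccupied : ∀ {n} → (Fin n × Fin n → Bool) → Set
LinesOccupied S = (∀ i → ∃[ j ] S (i , j) ≡ true) × (∀ j → ∃[ i ] S (i , j) ≡ true)

data Side (a b : ℕ) : Fin (a + b) → Set where
  left  : (i : Fin a) → Side a b (i ↑ˡ b)
  right : (j : Fin b) → Side a b (a ↑ʳ j)

side : ∀ a {b} (x : Fin (a + b)) → Side a b x
side zero    x       = right x
side (suc a) zero    = left zero
side (suc a) (suc x) with side a x
... | left i  = left (suc i)
... | right j = right j

↑ˡ≢↑ʳ : ∀ {a b} (i : Fin a) (j : Fin b) → i ↑ˡ b ≢ a ↑ʳ j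
↑ˡ≢↑ʳ {a} {b} i j eq with trans (sym (splitAt-↑ˡ a i b)) (trans (cong (splitAt a) eq) (splitAt-↑ʳ a b j))
... | ()

blockEntry : ∀ {a b} → (Fin a × Fin a → Bool) → (Fin b × Fin b → Bool) → Fin a ⊎ Fin b → Fin a ⊎ Fin b → Bool
blockEntry S T (inj₁ i) (inj₁ j) = S (i , j)
blockEntry S T (inj₂ i) (inj₂ j) = T (i , j)
blockEntry S T _        _        = false

_⊕_ : ∀ {a b} → (Fin a × Fin a → Bool) → (Fin b × Fin b → Bool) → Fin (a + b) × Fin (a + b) → Bool
_⊕_ {a} S T (x , y) = blockEntry S T (splitAt a x) (splitAt a y)

module _ {a b} (S : Fin a × Fin a → Bool) (T : Fin b × Fin b → Bool) where

  ⊕-↑ˡ↑ˡ : ∀ i j → (S ⊕ T) (i ↑ˡ b , j ↑ˡ b) ≡ S (i , j)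
  ⊕-↑ˡ↑ˡ i j = cong₂ (blockEntry S T) (splitAt-↑ˡ a i b) (splitAt-↑ˡ a j b)

  ⊕-↑ʳ↑ʳ : ∀ i j → (S ⊕ T) (a ↑ʳ i , a ↑ʳ j) ≡ T (i , j)
  ⊕-↑ʳ↑ʳ i j = cong₂ (blockEntry S T) (splitAt-↑ʳ a b i) (splitAt-↑ʳ a b j)

  ⊕-↑ˡ↑ʳ : ∀ i j → (S ⊕ T) (i ↑ˡ b , a ↑ʳ j) ≡ false
  ⊕-↑ˡ↑ʳ i j = cong₂ (blockEntry S T) (splitAt-↑ˡ a i b) (splitAt-↑ʳ a b j)

  ⊕-↑ʳ↑ˡ : ∀ i j → (S ⊕ T) (a ↑ʳ i , j ↑ˡ b) ≡ false
  ⊕-↑ʳ↑ˡ i j = cong₂ (blockEntry S T) (splitAt-↑ʳ a b i) (splitAt-↑ˡ a j b)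

  rowCount-⊕-↑ˡ : ∀ i → rowCount (S ⊕ T) (i ↑ˡ b) ≡ rowCount S i
  rowCount-⊕-↑ˡ i = begin
    rowCount (S ⊕ T) (i ↑ˡ b)
      ≡⟨ sum-↑ a (𝟙 ∘ row (S ⊕ T) (i ↑ˡ b)) ⟩
    count (λ j → (S ⊕ T) (i ↑ˡ b , j ↑ˡ b)) + count (λ j → (S ⊕ T) (i ↑ˡ b , a ↑ʳ j))
      ≡⟨ cong₂ _+_ (sum-cong-≗ (λ j → cong 𝟙 (⊕-↑ˡ↑ˡ i j))) (count-false _ (⊕-↑ˡ↑ʳ i)) ⟩
    rowCount S i + 0
      ≡⟨ +-identityʳ _ ⟩
    rowCount S i ∎
    where open ≡-Reasoning

  rowCount-⊕-↑ʳ : ∀ i → rowCount (S ⊕ T) (a ↑ʳ i) ≡ rowCount T i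
  rowCount-⊕-↑ʳ i = begin
    rowCount (S ⊕ T) (a ↑ʳ i)
      ≡⟨ sum-↑ a (𝟙 ∘ row (S ⊕ T) (a ↑ʳ i)) ⟩
    count (λ j → (S ⊕ T) (a ↑ʳ i , j ↑ˡ b)) + count (λ j → (S ⊕ T) (a ↑ʳ i , a ↑ʳ j))
      ≡⟨ cong₂ _+_ (count-false _ (⊕-↑ʳ↑ˡ i)) (sum-cong-≗ (λ j → cong 𝟙 (⊕-↑ʳ↑ʳ i j))) ⟩
    0 + rowCount T i ∎
    where open ≡-Reasoning

  card-⊕ : card (a + b) (S ⊕ T) ≡ card a S + card b T
  card-⊕ = begin
    card (a + b) (S ⊕ T)
      ≡⟨ card≡∑rowCount (S ⊕ T) ⟩
    sum (rowCount (S ⊕ T))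
      ≡⟨ sum-↑ a (rowCount (S ⊕ T)) ⟩
    sum (λ i → rowCount (S ⊕ T) (i ↑ˡ b)) + sum (λ i → rowCount (S ⊕ T) (a ↑ʳ i))
      ≡⟨ cong₂ _+_ (sum-cong-≗ rowCount-⊕-↑ˡ) (sum-cong-≗ rowCount-⊕-↑ʳ) ⟩
    sum (rowCount S) + sum (rowCount T)
      ≡⟨ cong₂ _+_ (card≡∑rowCount S) (card≡∑rowCount T) ⟨
    card a S + card b T ∎
    where open ≡-Reasoning

TwoNeighbours : (G : Graph) → (V G → Bool) → V G → Set
TwoNeighbours G S v = ∃[ p ] ∃[ q ] (p ≢ q × S p ≡ true × S q ≡ true × Adj G v p × Adj G v q)

module _ {m N} (f : Fin m → Fin N) (f-injective : ∀ {x y} → f x ≡ f y → x ≡ y)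
         {S : Fin m × Fin m → Bool} {S′ : Fin N × Fin N → Bool}
         (S′-f≡S : ∀ i j → S′ (f i , f j) ≡ S (i , j)) where

  embed : Fin m × Fin m → Fin N × Fin N
  embed (i , j) = f i , f j

  embed-adj : ∀ {v w} → Adj (K m □ K m) v w → Adj (K N □ K N) (embed v) (embed w)
  embed-adj (inj₁ (eq , j≢j′)) = inj₁ (cong f eq , j≢j′ ∘ f-injective)
  embed-adj (inj₂ (eq , i≢i′)) = inj₂ (cong f eq , i≢i′ ∘ f-injective)

  embed-twoNeighbours : ∀ {v} → TwoNeighbours (K m □ K m) S v → TwoNeighbours (K N □ K N) S′ (embed v)
  embed-twoNeighbours ((p₁ , p₂) , (q₁ , q₂) , p≢q , Sp , Sq , v~p , v~q) =
    embed (p₁ , p₂) , embed (q₁ , q₂) ,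
    (λ eq → p≢q (cong₂ _,_ (f-injective (cong proj₁ eq)) (f-injective (cong proj₂ eq)))) ,
    trans (S′-f≡S p₁ p₂) Sp , trans (S′-f≡S q₁ q₂) Sq , embed-adj v~p , embed-adj v~q

module _ {a b} {S : Fin a × Fin a → Bool} {T : Fin b × Fin b → Bool} where

  ⊕-dominating : IsTotal2Dominating (K a □ K a) S → LinesOccupied S →
                 IsTotal2Dominating (K b □ K b) T → LinesOccupied T →
                 IsTotal2Dominating (K (a + b) □ K (a + b)) (S ⊕ T)
  ⊕-dominating domS (rowS , colS) domT (rowT , colT) (x , y) with side a x | side a y
  ... | left i  | left j  = embed-twoNeighbours (_↑ˡ b) (↑ˡ-injective b _ _) (⊕-↑ˡ↑ˡ S T) (domS (i , j))
  ... | right i | right j = embed-twoNeighbours (a ↑ʳ_) (↑ʳ-injective a _ _) (⊕-↑ʳ↑ʳ S T) (domT (i , j))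
  ... | left i  | right j with rowS i | colT j
  ...   | j′ , Sij′ | i′ , Ti′j =
    (i ↑ˡ b , j′ ↑ˡ b) , (a ↑ʳ i′ , a ↑ʳ j) , ↑ˡ≢↑ʳ i i′ ∘ cong proj₁ ,
    trans (⊕-↑ˡ↑ˡ S T i j′) Sij′ , trans (⊕-↑ʳ↑ʳ S T i′ j) Ti′j ,
    inj₁ (refl , ↑ˡ≢↑ʳ j′ j ∘ sym) , inj₂ (refl , ↑ˡ≢↑ʳ i i′)
  ⊕-dominating domS (rowS , colS) domT (rowT , colT) (x , y) | right i | left j with rowT i | colS j
  ...   | j′ , Tij′ | i′ , Si′j =
    (a ↑ʳ i , a ↑ʳ j′) , (i′ ↑ˡ b , j ↑ˡ b) , ↑ˡ≢↑ʳ i′ i ∘ sym ∘ cong proj₁ ,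
    trans (⊕-↑ʳ↑ʳ S T i j′) Tij′ , trans (⊕-↑ˡ↑ˡ S T i′ j) Si′j ,
    inj₁ (refl , ↑ˡ≢↑ʳ j j′) , inj₂ (refl , ↑ˡ≢↑ʳ i′ i ∘ sym)

  ⊕-linesOccupied : LinesOccupied S → LinesOccupied T → LinesOccupied (S ⊕ T)
  ⊕-linesOccupied (rowS , colS) (rowT , colT) = occupiedRow , occupiedCol
    where
    occupiedRow : ∀ x → ∃[ y ] (S ⊕ T) (x , y) ≡ true
    occupiedRow x with side a x
    ... | left i  = proj₁ (rowS i) ↑ˡ b , trans (⊕-↑ˡ↑ˡ S T i _) (proj₂ (rowS i))
    ... | right i = a ↑ʳ proj₁ (rowT i) , trans (⊕-↑ʳ↑ʳ S T i _) (proj₂ (rowT i))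
    occupiedCol : ∀ y → ∃[ x ] (S ⊕ T) (x , y) ≡ true
    occupiedCol y with side a y
    ... | left j  = proj₁ (colS j) ↑ˡ b , trans (⊕-↑ˡ↑ˡ S T _ j) (proj₂ (colS j))
    ... | right j = a ↑ʳ proj₁ (colT j) , trans (⊕-↑ʳ↑ʳ S T _ j) (proj₂ (colT j))

module _ {n : ℕ} where

  ∀-vertex? : {P : Fin n × Fin n → Set} → (∀ v → Dec (P v)) → Dec (∀ v → P v)
  ∀-vertex? P? = map′ (λ h (i , j) → h i j) (λ h i j → h (i , j)) (all? λ i → all? λ j → P? (i , j))

  ∃-vertex? : {P : Fin n × Fin n → Set} → (∀ v → Dec (P v)) → Dec (∃ P)
  ∃-vertex? P? = map′ (λ (i , j , p) → (i , j) , p) (λ ((i , j) , p) → i , j , p)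
                      (any? λ i → any? λ j → P? (i , j))

  adj? : ∀ v w → Dec (Adj (K n □ K n) v w)
  adj? (i , j) (i′ , j′) = ((i ≟ᶠ i′) ×-dec ¬? (j ≟ᶠ j′)) ⊎-dec ((j ≟ᶠ j′) ×-dec ¬? (i ≟ᶠ i′))

  total2Dominating? : (S : Fin n × Fin n → Bool) → Dec (IsTotal2Dominating (K n □ K n) S)
  total2Dominating? S = ∀-vertex? λ v → ∃-vertex? λ p → ∃-vertex? λ q →
    ¬? (≡-dec _≟ᶠ_ _≟ᶠ_ p q) ×-dec (S p ≟ᵇ true) ×-dec (S q ≟ᵇ true) ×-dec adj? v p ×-dec adj? v q

  linesOccupied? : (S : Fin n × Fin n → Bool) → Dec (LinesOccupied S)
  linesOccupied? S = (all? λ i → any? λ j → S (i , j) ≟ᵇ true) ×-dec (all? λ j → any? λ i → S (i , j) ≟ᵇ true)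

  fromList : List (ℕ × ℕ) → Fin n × Fin n → Bool
  fromList cells (i , j) = any (λ (p , q) → (toℕ i ≡ᵇ p) ∧ (toℕ j ≡ᵇ q)) cells

record Construction (n : ℕ) (S : Fin n × Fin n → Bool) : Set where
  field
    dominating : IsTotal2Dominating (K n □ K n) S
    occupied   : LinesOccupied S
    size       : card n S ≡ formula n
open Construction

certify : ∀ n (S : Fin n × Fin n → Bool) → {True (total2Dominating? S)} → {True (linesOccupied? S)} →
          card n S ≡ formula n → Construction n S
certify n S {dom} {occ} size = record { dominating = toWitness dom ; occupied = toWitness occ ; size = size }

S₂ : Fin 2 × Fin 2 → Bool
S₂ = fromList ((0 , 0) ∷ (0 , 1) ∷ (1 , 0) ∷ (1 , 1) ∷ [])

S₃ : Fin 3 × Fin 3 → Bool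
S₃ = fromList ((0 , 0) ∷ (0 , 1) ∷ (0 , 2) ∷ (1 , 0) ∷ (2 , 0) ∷ [])

S₄ : Fin 4 × Fin 4 → Bool
S₄ = fromList ((0 , 0) ∷ (0 , 1) ∷ (0 , 2) ∷ (1 , 3) ∷ (2 , 3) ∷ (3 , 3) ∷ [])

S₅ : Fin 5 × Fin 5 → Bool
S₅ = fromList ((0 , 0) ∷ (0 , 1) ∷ (0 , 2) ∷ (0 , 3) ∷ (1 , 4) ∷ (2 , 4) ∷ (3 , 4) ∷ (4 , 4) ∷ [])

construction₄ : Construction 4 S₄
construction₄ = certify 4 S₄ refl

construction : ∀ n → 2 ≤ n → ∃[ S ] Construction n S
construction 1 (s≤s ())
construction 2 _ = S₂ , certify 2 S₂ refl
construction 3 _ = S₃ , certify 3 S₃ refl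
construction 4 _ = S₄ , construction₄
construction 5 _ = S₅ , certify 5 S₅ refl
construction (suc (suc (suc (suc n@(suc (suc _)))))) _ with construction n (s≤s (s≤s z≤n))
... | S , c = S₄ ⊕ S , record
  { dominating = ⊕-dominating (dominating construction₄) (occupied construction₄) (dominating c) (occupied c)
  ; occupied   = ⊕-linesOccupied (occupied construction₄) (occupied c)
  ; size       = trans (card-⊕ S₄ S) (trans (cong (6 +_) (size c)) (sym (formula-step n)))
  }

theorem2p10 : (n : ℕ) → 2 ≤ n → γ2t-KnKn≡ n (formula n)
theorem2p10 n 2≤n with construction n 2≤n
... | S , c = (S , dominating c , size c) , λ T domT → formula≤ n (card n T) (lowerBound T domT)
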